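{- Let $G=\operatorname{Dih}(A)$ where $A$ is a finite abelian group of odd order and $d(A)=2$. If $X_I\in\mathcal{O}_m$ with $m\in\{2,3\}$, then $X_I$ has an option in $\mathcal{O}_{m-1}$.
   Context: $d(A)$ is the minimum size of a generating set of $A$. $\operatorname{Dih}(A)=C_2\ltimes A$ with $C_2=\{1,x\}$ and $x$ acting on $A$ by inversion. Let $G$ be a finite group. The game positions of $\text{GEN}(G)$ are the non-generating subsets of $G$ (nonterminal) together with the generating sets $S$ having some $g\in S$ with $\langle S\setminus\{g\}\rangle\ne G$ (terminal). Let $\mathcal{M}$ be the set of maximal subgroups of $G$ and $\mathcal{I}=\{\cap\mathcal{N}:\emptyset\neq\mathcal{N}\subseteq\mathcal{M}\}$ the set of intersection subgroups. For $I\in\mathcal{I}$, the structure class $X_I$ is the set of subsets of $I$ that are not contained in any $J\in\mathcal{I}$ with $J\subsetneq I$; $X_G$ is the set of terminal positions. Every position $P$ lies in a unique $X_I$, $I\in\mathcal{I}\cup\{G\}$; write $\lceil P\rceil$ for this $I$. For $I\in\mathcal{I}$ and $K\in\mathcal{I}\cup\{G\}$, $X_K$ is an option of $X_I$ if $I\cup\{g\}\in X_K$ for some $g\in G\setminus I$. The deficiency $\delta(P)$ of $P\subseteq G$ is the minimum size of $Q\subseteq G$ with $\langle P\cup Q\rangle=G$, and $\delta(X_I):=\delta(I)$. $X_I$ is odd (even) if $|I|$ is odd (even). $\mathcal{O}_m$ denotes the set of odd structure classes $X_I$ (with $I\in\mathcal{I}\cup\{G\}$) with $\delta(X_I)=m$.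 -}

module Defs where

open import Data.Nat using (ℕ; zero; suc; _*_; _≤_; _%_)
open import Data.Fin using (Fin; zero; suc; remQuot; combine)
open import Data.Fin.Subset using (Subset; _∈_; _∉_; _⊆_; _⊂_; _∩_; _∪_; _-_; ⁅_⁆; ⊤; ∣_∣)
open import Data.Product using (Σ; ∃; _×_; _,_)
open import Data.Sum using (_⊎_)
open import Data.List using (List; foldr)
open import Data.List.Relation.Unary.All using (All)
open import Relation.Nullary using (¬_)
open import Relation.Binary.PropositionalEquality using (_≡_)

record GroupOps : Set where
  field
    order : ℕ
    _·_   : Fin order → Fin order → Fin order
    e     : Fin order
    inv   : Fin order → Fin order

open GroupOps public

record IsGroup (G : GroupOps) : Set where
  field
    assoc   : ∀ x y z → (G · ((G · x) y)) z ≡ (G · x) ((G · y) z)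
    idˡ     : ∀ x → (G · e G) x ≡ x
    idʳ     : ∀ x → (G · x) (e G) ≡ x
    invˡ    : ∀ x → (G · inv G x) x ≡ e G
    invʳ    : ∀ x → (G · x) (inv G x) ≡ e G

IsAbelian : GroupOps → Set
IsAbelian G = ∀ x y → (G · x) y ≡ (G · y) x

Odd : ℕ → Set
Odd k = k % 2 ≡ 1

-- Dih(A) = C₂ ⋉ A, x acting by inversion.  Elements are pairs (s , a)
-- (standing for x^s a), encoded in Fin (2 * |A|) via combine/remQuot.

module _ (A : GroupOps) where
  private
    N = order A
    _∘A_ = _·_ A

  xor2 : Fin 2 → Fin 2 → Fin 2
  xor2 zero t = t
  xor2 (suc zero) zero = suc zero
  xor2 (suc zero) (suc zero) = zero

  act : Fin 2 → Fin N → Fin N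
  act zero a = a
  act (suc zero) a = inv A a

  dmul : Fin 2 × Fin N → Fin 2 × Fin N → Fin 2 × Fin N
  dmul (s , a) (t , b) = xor2 s t , (act t a ∘A b)

  dinv : Fin 2 × Fin N → Fin 2 × Fin N
  dinv (s , a) = s , act s (inv A a)

  Dih : GroupOps
  Dih = record
    { order = 2 * N
    ; _·_   = λ p q → enc (dmul (remQuot {2} N p) (remQuot {2} N q))
    ; e     = combine {2} {N} zero (e A)
    ; inv   = λ p → enc (dinv (remQuot {2} N p))
    }
    where
      enc : Fin 2 × Fin N → Fin (2 * N)
      enc (s , a) = combine {2} {N} s a

module _ (G : GroupOps) where
  private
    n = order G

  data InGen (S : Subset n) : Fin n → Set where
    gen  : ∀ {x} → x ∈ S → InGen S x
    one  : InGen S (e G)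
    mul  : ∀ {x y} → InGen S x → InGen S y → InGen S ((G · x) y)
    inve : ∀ {x} → InGen S x → InGen S (inv G x)

  Generates : Subset n → Set
  Generates S = ∀ x → InGen S x

  Rank : ℕ → Set
  Rank d = (Σ (Subset n) λ S → ∣ S ∣ ≡ d × Generates S)
         × (∀ S → Generates S → d ≤ ∣ S ∣)

  IsSubgroup : Subset n → Set
  IsSubgroup H = (e G ∈ H)
               × (∀ {x y} → x ∈ H → y ∈ H → (G · x) y ∈ H)
               × (∀ {x} → x ∈ H → inv G x ∈ H)

  IsMaximal : Subset n → Set
  IsMaximal M = IsSubgroup M × M ⊂ ⊤
              × (∀ K → IsSubgroup K → M ⊆ K → K ≡ M ⊎ K ≡ ⊤)

  IsInter : Subset n → Set
  IsInter I = Σ (Subset n) λ M → Σ (List (Subset n)) λ Ms →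
              IsMaximal M × All IsMaximal Ms × I ≡ foldr _∩_ M Ms

  ClassIndex : Subset n → Set
  ClassIndex I = IsInter I ⊎ I ≡ ⊤

  Terminal : Subset n → Set
  Terminal S = Generates S × (Σ (Fin n) λ g → g ∈ S × ¬ Generates (S - g))

  data InClass (K : Subset n) (P : Subset n) : Set where
    inter : IsInter K → P ⊆ K
          → (∀ J → IsInter J → J ⊂ K → ¬ (P ⊆ J)) → InClass K P
    top   : K ≡ ⊤ → Terminal P → InClass K P

  Deficiency : Subset n → ℕ → Set
  Deficiency P m = (Σ (Subset n) λ Q → ∣ Q ∣ ≡ m × Generates (P ∪ Q))
                 × (∀ Q → Generates (P ∪ Q) → m ≤ ∣ Q ∣)

  IsOption : Subset n → Subset n → Set
  IsOption I K = Σ (Fin n) λ g → g ∉ I × InClass K (I ∪ ⁅ g ⁆)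

  InO : ℕ → Subset n → Set
  InO m I = ClassIndex I × Odd ∣ I ∣ × Deficiency I m

-- Call the elements of A ⊆ Dih(A) rotations and the others reflections. Since |A| is odd,
-- a subgroup of Dih(A) has odd order exactly when it consists of rotations: left
-- multiplication by a reflection pairs off its elements, while inversion on a group of
-- rotations fixes only e. So an odd class X_I has I ⊆ A, and a set Q of minimal size
-- δ(I) ≥ 2 with ⟨I ∪ Q⟩ = Dih(A) contains a reflection r and a second element q. Trading q
-- for the rotation g = q or g = r q keeps (I ∪ {g}) ∪ (Q ∖ {q}) generating, so
-- δ(I ∪ {g}) = δ(I) − 1. The class of I ∪ {g} is indexed by K = ⌈I ∪ {g}⌉ ⊆ A, which is odd,
-- and δ(K) = δ(I ∪ {g}) because K lies in every maximal subgroup containing I ∪ {g}.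

module Submission where

open import Defs
open import Level using (0ℓ)
open import Data.Nat using (ℕ; zero; suc; _+_; _*_; _∸_; _≤_; _<_; z≤n; s≤s; s≤s⁻¹)
open import Data.Nat.Properties using (module ≤-Reasoning; ≤-trans; ≤-reflexive; +-monoʳ-≤; +-suc; n≤1+n; suc-injective; 1+n≰n)
open import Data.Nat.DivMod using (m*n%n≡0; [m+kn]%n≡m%n)
open import Data.Bool using () renaming (_≟_ to _≟ᴮ_)
open import Data.Fin using (Fin; zero; suc; combine; remQuot) renaming (_≟_ to _≟ᶠ_)
open import Data.Fin.Properties using (any?; all?; remQuot-combine; combine-remQuot)
open import Data.Fin.Subset
open import Data.Fin.Subset.Properties
open import Data.Fin.Subset.Induction using (Acc; acc; ⊂-wellFounded; ⊃-wellFounded)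
open import Data.Vec using ([]; _∷_; here; there; tabulate)
open import Data.Vec.Properties using (≡-dec; lookup∘tabulate; []=⇒lookup; lookup⇒[]=)
open import Data.List using (List; []; _∷_; foldr)
open import Data.List.Relation.Unary.All as All using (All; []; _∷_)
open import Data.Product using (Σ; ∃; ∃₂; _×_; _,_; proj₁; proj₂; uncurry)
open import Data.Sum using (_⊎_; inj₁; inj₂; [_,_]′)
open import Data.Empty using (⊥-elim)
open import Function using (_∘_; id; _⇔_; mk⇔; Equivalence)
open import Relation.Nullary using (¬_; Dec; yes; no; does; contradiction)
open import Relation.Nullary.Decidable as Dec using (_×-dec_; _→-dec_; _⊎-dec_; ¬?; dec-true; decidable-stable)
open import Relation.Unary using (Decidable)
open import Relation.Binary.PropositionalEquality using (_≡_; _≢_; refl; sym; trans; cong; cong₂; subst; module ≡-Reasoning)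
open import Relation.Binary.PropositionalEquality.Algebra using (isMagma)
import Algebra.Bundles as Bundles
import Algebra.Properties.Group as GroupProperties

private
  variable
    n : ℕ
    p q r : Subset n
    x y : Fin n
    qs : List (Subset n)

x∈p─q⇒x∉q : ∀ (p q : Subset n) → x ∈ p ─ q → x ∉ q
x∈p─q⇒x∉q (s ∷ p) (outside ∷ q) here        = λ ()
x∈p─q⇒x∉q (s ∷ p) (t ∷ q)       (there x∈) = x∈p─q⇒x∉q p q x∈ ∘ drop-there

x∈p-y⇒x≢y : x ∈ p - y → x ≢ y
x∈p-y⇒x≢y {p = p} {y = y} x∈ refl = x∈p─q⇒x∉q p ⁅ y ⁆ x∈ (x∈⁅x⁆ y)

x∈p⇒suc∣p-x∣≡∣p∣ : x ∈ p → suc ∣ p - x ∣ ≡ ∣ p ∣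
x∈p⇒suc∣p-x∣≡∣p∣ {x = zero}  {p = inside  ∷ p} here        = cong (suc ∘ ∣_∣) (p─⊥≡p p)
x∈p⇒suc∣p-x∣≡∣p∣ {x = suc x} {p = inside  ∷ p} (there x∈) = cong suc (x∈p⇒suc∣p-x∣≡∣p∣ x∈)
x∈p⇒suc∣p-x∣≡∣p∣ {x = suc x} {p = outside ∷ p} (there x∈) = x∈p⇒suc∣p-x∣≡∣p∣ x∈

∣p∪q∣≤∣p∣+∣q∣ : ∀ (p q : Subset n) → ∣ p ∪ q ∣ ≤ ∣ p ∣ + ∣ q ∣
∣p∪q∣≤∣p∣+∣q∣ []            []            = z≤n
∣p∪q∣≤∣p∣+∣q∣ (inside  ∷ p) (inside  ∷ q) = s≤s (≤-trans (∣p∪q∣≤∣p∣+∣q∣ p q) (+-monoʳ-≤ ∣ p ∣ (n≤1+n _)))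
∣p∪q∣≤∣p∣+∣q∣ (inside  ∷ p) (outside ∷ q) = s≤s (∣p∪q∣≤∣p∣+∣q∣ p q)
∣p∪q∣≤∣p∣+∣q∣ (outside ∷ p) (inside  ∷ q) = ≤-trans (s≤s (∣p∪q∣≤∣p∣+∣q∣ p q)) (≤-reflexive (sym (+-suc _ _)))
∣p∪q∣≤∣p∣+∣q∣ (outside ∷ p) (outside ∷ q) = ∣p∪q∣≤∣p∣+∣q∣ p q

∪-lub : p ⊆ r → q ⊆ r → p ∪ q ⊆ r
∪-lub {p = p} {q = q} p⊆r q⊆r = [ p⊆r , q⊆r ]′ ∘ x∈p∪q⁻ p q

∪-monoˡ : p ⊆ q → p ∪ r ⊆ q ∪ r
∪-monoˡ {q = q} {r = r} p⊆q = ∪-lub (p⊆p∪q r ∘ p⊆q) (q⊆p∪q q r)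

x∈p⇒⁅x⁆⊆p : x ∈ p → ⁅ x ⁆ ⊆ p
x∈p⇒⁅x⁆⊆p {x = x} {p = p} x∈p y∈⁅x⁆ = subst (_∈ p) (sym (x∈⁅y⁆⇒x≡y x y∈⁅x⁆)) x∈p

p⊂p∪⁅x⁆ : x ∉ p → p ⊂ p ∪ ⁅ x ⁆
p⊂p∪⁅x⁆ {x = x} {p = p} x∉p = p⊆p∪q ⁅ x ⁆ , x , q⊆p∪q p ⁅ x ⁆ (x∈⁅x⁆ x) , x∉p

p⊈q⇒∃x∈p∖q : ¬ p ⊆ q → ∃ λ x → x ∈ p × x ∉ q
p⊈q⇒∃x∈p∖q {p = p} {q = q} p⊈q with any? (λ x → (x ∈? p) ×-dec ¬? (x ∈? q))
... | yes witness = witness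
... | no ∄ = contradiction (λ {x} x∈p → decidable-stable (x ∈? q) (λ x∉q → ∄ (x , x∈p , x∉q))) p⊈q

p⊆q∧q⊈p⇒p⊂q : p ⊆ q → ¬ q ⊆ p → p ⊂ q
p⊆q∧q⊈p⇒p⊂q p⊆q q⊈p = p⊆q , p⊈q⇒∃x∈p∖q q⊈p

p⊆q∧p≢q⇒p⊂q : p ⊆ q → p ≢ q → p ⊂ q
p⊆q∧p≢q⇒p⊂q p⊆q p≢q = p⊆q∧q⊈p⇒p⊂q p⊆q (p≢q ∘ ⊆-antisym p⊆q)

_≟ˢ_ : (p q : Subset n) → Dec (p ≡ q)
_≟ˢ_ = ≡-dec _≟ᴮ_

x∈p∧1<∣p∣⇒∃[p-x] : ∀ {n} {p : Subset n} {x} → x ∈ p → 1 < ∣ p ∣ → Nonempty (p - x)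
x∈p∧1<∣p∣⇒∃[p-x] {n} {p} {x} x∈p 1<∣p∣ with nonempty? (p - x)
... | yes ne = ne
... | no ∅ = ⊥-elim (1+n≰n (≤-trans 1<∣p∣ (≤-reflexive ∣p∣≡1)))
  where
  ∣p∣≡1 : ∣ p ∣ ≡ 1
  ∣p∣≡1 = trans (sym (x∈p⇒suc∣p-x∣≡∣p∣ x∈p)) (cong suc (trans (cong ∣_∣ (Empty-unique ∅)) (∣⊥∣≡0 n)))

fromDecidable : {P : Fin n → Set} → Decidable P → Subset n
fromDecidable P? = tabulate (does ∘ P?)

fromDecidable⁺ : {P : Fin n → Set} (P? : Decidable P) → P x → x ∈ fromDecidable P?
fromDecidable⁺ {x = x} P? px = lookup⇒[]= x _ (trans (lookup∘tabulate (does ∘ P?) x) (dec-true (P? x) px))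

fromDecidable⁻ : {P : Fin n → Set} (P? : Decidable P) → x ∈ fromDecidable P? → P x
fromDecidable⁻ {x = x} P? x∈ with P? x | trans (sym (lookup∘tabulate (does ∘ P?) x)) ([]=⇒lookup x∈)
... | yes px | _ = px
... | no _   | ()

⊆-foldr-∩⁺ : p ⊆ q → All (p ⊆_) qs → p ⊆ foldr _∩_ q qs
⊆-foldr-∩⁺ p⊆q []           = p⊆q
⊆-foldr-∩⁺ p⊆q (p⊆q′ ∷ p⊆qs) x∈p = x∈p∩q⁺ (p⊆q′ x∈p , ⊆-foldr-∩⁺ p⊆q p⊆qs x∈p)

⊆-foldr-∩⁻ : p ⊆ foldr _∩_ q qs → p ⊆ q × All (p ⊆_) qs
⊆-foldr-∩⁻ {qs = []}      p⊆ = p⊆ , []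
⊆-foldr-∩⁻ {q = q} {qs = q′ ∷ qs} p⊆
  with ⊆-foldr-∩⁻ {qs = qs} (p∩q⊆q q′ (foldr _∩_ q qs) ∘ p⊆)
... | p⊆q , p⊆qs = p⊆q , (p∩q⊆p q′ _ ∘ p⊆) ∷ p⊆qs

Even : ℕ → Set
Even k = ∃ λ j → k ≡ j * 2

Even⇒¬Odd : ∀ {k} → Even k → ¬ Odd k
Even⇒¬Odd (j , refl) odd with trans (sym (m*n%n≡0 j 2)) odd
... | ()

Even⇒Odd[1+] : ∀ {k} → Even k → Odd (suc k)
Even⇒Odd[1+] (j , refl) = [m+kn]%n≡m%n 1 j 2

InvolutionOn : (Fin n → Fin n) → Subset n → Set
InvolutionOn σ P = ∀ {x} → x ∈ P → σ x ∈ P × σ (σ x) ≡ x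

fixedPointFree⇒Even : ∀ {n} (σ : Fin n → Fin n) P → InvolutionOn σ P →
                      (∀ {x} → x ∈ P → σ x ≢ x) → Even ∣ P ∣
fixedPointFree⇒Even {n} σ P = go P (⊂-wellFounded P)
  where
  go : ∀ P → Acc _⊂_ P → InvolutionOn σ P → (∀ {x} → x ∈ P → σ x ≢ x) → Even ∣ P ∣
  go P (acc rec) invol free with nonempty? P
  ... | no ∅ = 0 , trans (cong ∣_∣ (Empty-unique ∅)) (∣⊥∣≡0 n)
  ... | yes (x , x∈P) with go P′ (rec P′⊂P) invol′ (free ∘ proj₁ ∘ ∈P′⁻)
    where
    P′ = P - x - σ x
    P′⊂P : P′ ⊂ P
    P′⊂P = ⊆-⊂-trans (p─q⊆p (P - x) ⁅ σ x ⁆) (x∈p⇒p-x⊂p x∈P)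
    ∈P′⁻ : ∀ {z} → z ∈ P′ → z ∈ P × z ≢ x × z ≢ σ x
    ∈P′⁻ z∈ = p─q⊆p P ⁅ x ⁆ z∈P-x , x∈p-y⇒x≢y z∈P-x , x∈p-y⇒x≢y z∈
      where z∈P-x = p─q⊆p (P - x) ⁅ σ x ⁆ z∈
    invol′ : InvolutionOn σ P′
    invol′ z∈ with ∈P′⁻ z∈
    ... | z∈P , z≢x , z≢σx with invol z∈P
    ... | σz∈P , σσz≡z =
      x∈p∧x≢y⇒x∈p-y (x∈p∧x≢y⇒x∈p-y σz∈P (λ σz≡x → z≢σx (trans (sym σσz≡z) (cong σ σz≡x))))
                    (λ σz≡σx → z≢x (trans (sym σσz≡z) (trans (cong σ σz≡σx) (proj₂ (invol x∈P))))) ,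
      σσz≡z
  ... | j , ∣P-x-σx∣≡2j = suc j , trans (sym (x∈p⇒suc∣p-x∣≡∣p∣ x∈P))
                                        (cong suc (trans (sym (x∈p⇒suc∣p-x∣≡∣p∣ σx∈P-x)) (cong suc ∣P-x-σx∣≡2j)))
    where
    σx∈P-x : σ x ∈ P - x
    σx∈P-x = x∈p∧x≢y⇒x∈p-y (proj₁ (invol x∈P)) (free x∈P)

uniqueFixedPoint⇒Odd : ∀ (σ : Fin n → Fin n) P {c} → InvolutionOn σ P → c ∈ P → σ c ≡ c →
                       (∀ {x} → x ∈ P → σ x ≡ x → x ≡ c) → Odd ∣ P ∣
uniqueFixedPoint⇒Odd σ P {c} invol c∈P σc≡c unique =
  subst Odd (x∈p⇒suc∣p-x∣≡∣p∣ c∈P) (Even⇒Odd[1+] (fixedPointFree⇒Even σ (P - c) invol′ free))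
  where
  invol′ : InvolutionOn σ (P - c)
  invol′ {z} z∈ = x∈p∧x≢y⇒x∈p-y (proj₁ (invol z∈P)) σz≢c , proj₂ (invol z∈P)
    where
    z∈P : z ∈ P
    z∈P = p─q⊆p P ⁅ c ⁆ z∈
    σz≢c : σ z ≢ c
    σz≢c σz≡c = x∈p-y⇒x≢y z∈ (trans (sym (proj₂ (invol z∈P))) (trans (cong σ σz≡c) σc≡c))
  free : ∀ {z} → z ∈ P - c → σ z ≢ z
  free z∈ σz≡z = x∈p-y⇒x≢y z∈ (unique (p─q⊆p P ⁅ c ⁆ z∈) σz≡z)

module FiniteGroup (G : GroupOps) where

  private
    N = order G
    _⋆_ = _·_ G
    variable
      S T H K M J Q : Subset N

  _⊆⟨_⟩ : Subset N → Subset N → Set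
  T ⊆⟨ S ⟩ = ∀ {x} → x ∈ T → InGen G S x

  InGen-trans : S ⊆⟨ T ⟩ → ∀ {x} → InGen G S x → InGen G T x
  InGen-trans S⊆⟨T⟩ (gen x∈S)  = S⊆⟨T⟩ x∈S
  InGen-trans S⊆⟨T⟩ one        = one
  InGen-trans S⊆⟨T⟩ (mul x y)  = mul (InGen-trans S⊆⟨T⟩ x) (InGen-trans S⊆⟨T⟩ y)
  InGen-trans S⊆⟨T⟩ (inve x)   = inve (InGen-trans S⊆⟨T⟩ x)

  Generates-mono : S ⊆ T → Generates G S → Generates G T
  Generates-mono S⊆T gen-S x = InGen-trans (gen ∘ S⊆T) (gen-S x)

  InGen⇒∈ : IsSubgroup G H → S ⊆ H → ∀ {x} → InGen G S x → x ∈ H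
  InGen⇒∈ _                S⊆H (gen x∈S) = S⊆H x∈S
  InGen⇒∈ (e∈H , _ , _)    S⊆H one       = e∈H
  InGen⇒∈ sH@(_ , ·∈H , _) S⊆H (mul x y) = ·∈H (InGen⇒∈ sH S⊆H x) (InGen⇒∈ sH S⊆H y)
  InGen⇒∈ sH@(_ , _ , ⁻¹∈H) S⊆H (inve x) = ⁻¹∈H (InGen⇒∈ sH S⊆H x)

  ∩-isSubgroup : IsSubgroup G H → IsSubgroup G K → IsSubgroup G (H ∩ K)
  ∩-isSubgroup {H} {K} (e∈H , ·∈H , ⁻¹∈H) (e∈K , ·∈K , ⁻¹∈K) =
    x∈p∩q⁺ (e∈H , e∈K) ,
    (λ x∈ y∈ → x∈p∩q⁺ (·∈H (p∩q⊆p H K x∈) (p∩q⊆p H K y∈) , ·∈K (p∩q⊆q H K x∈) (p∩q⊆q H K y∈))) ,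
    (λ x∈ → x∈p∩q⁺ (⁻¹∈H (p∩q⊆p H K x∈) , ⁻¹∈K (p∩q⊆q H K x∈)))

  foldr-∩-isSubgroup : ∀ {Ms} → IsSubgroup G M → All (IsSubgroup G) Ms → IsSubgroup G (foldr _∩_ M Ms)
  foldr-∩-isSubgroup sM []          = sM
  foldr-∩-isSubgroup sM (sM′ ∷ sMs) = ∩-isSubgroup sM′ (foldr-∩-isSubgroup sM sMs)

  IsInter⇒IsSubgroup : IsInter G J → IsSubgroup G J
  IsInter⇒IsSubgroup (M , Ms , mM , mMs , refl) = foldr-∩-isSubgroup (proj₁ mM) (All.map proj₁ mMs)

  ClassIndex⇒IsSubgroup : ClassIndex G J → IsSubgroup G J
  ClassIndex⇒IsSubgroup (inj₁ iJ)   = IsInter⇒IsSubgroup iJ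
  ClassIndex⇒IsSubgroup (inj₂ refl) = ∈⊤ , (λ _ _ → ∈⊤) , (λ _ → ∈⊤)

  isSubgroup? : Decidable (IsSubgroup G)
  isSubgroup? H with (e G ∈? H)
                    ×-dec all? (λ x → all? (λ y → (x ∈? H) →-dec ((y ∈? H) →-dec ((x ⋆ y) ∈? H))))
                    ×-dec all? (λ x → (x ∈? H) →-dec (inv G x ∈? H))
  ... | yes (e∈ , ·∈ , ⁻¹∈) = yes (e∈ , (λ {x} {y} → ·∈ x y) , λ {x} → ⁻¹∈ x)
  ... | no ¬closed          = no λ (e∈ , ·∈ , ⁻¹∈) → ¬closed (e∈ , (λ x y → ·∈) , λ x → ⁻¹∈)

  ProperSubgroup : Subset N → Set
  ProperSubgroup H = IsSubgroup G H × H ⊂ ⊤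

  properSubgroup? : Decidable ProperSubgroup
  properSubgroup? H = isSubgroup? H ×-dec (H ⊂? ⊤)

  Generates⇒⊈ : Generates G S → ProperSubgroup H → ¬ S ⊆ H
  Generates⇒⊈ gen-S (sH , _ , x , _ , x∉H) S⊆H = x∉H (InGen⇒∈ sH S⊆H (gen-S x))

  MaximalProper : Subset N → Set
  MaximalProper M = ProperSubgroup M × ¬ ∃ λ K → M ⊂ K × ProperSubgroup K

  MaximalProper⇔IsMaximal : MaximalProper M ⇔ IsMaximal G M
  MaximalProper⇔IsMaximal {M} = mk⇔ to from
    where
    to : MaximalProper M → IsMaximal G M
    to ((sM , M⊂⊤) , ∄) = sM , M⊂⊤ , between
      where
      between : ∀ K → IsSubgroup G K → M ⊆ K → K ≡ M ⊎ K ≡ ⊤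
      between K sK M⊆K with K ≟ˢ M | K ≟ˢ ⊤
      ... | yes K≡M | _       = inj₁ K≡M
      ... | no _    | yes K≡⊤ = inj₂ K≡⊤
      ... | no K≢M  | no K≢⊤  = ⊥-elim (∄ (K , p⊆q∧p≢q⇒p⊂q M⊆K (K≢M ∘ sym) , sK , p⊆q∧p≢q⇒p⊂q ⊆⊤ K≢⊤))
    from : IsMaximal G M → MaximalProper M
    from (sM , M⊂⊤ , maximal) = (sM , M⊂⊤) , λ (K , M⊂K , sK , K⊂⊤) →
      [ (λ K≡M → ⊂-irref (sym K≡M) M⊂K) , (λ K≡⊤ → ⊂-irref K≡⊤ K⊂⊤) ]′ (maximal K sK (proj₁ M⊂K))

  isMaximal? : Decidable (IsMaximal G)
  isMaximal? M = Dec.map MaximalProper⇔IsMaximal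
    (properSubgroup? M ×-dec ¬? (anySubset? (λ K → (M ⊂? K) ×-dec properSubgroup? K)))

  ProperSubgroup⇒⊆maximal : ProperSubgroup H → ∃ λ M → IsMaximal G M × H ⊆ M
  ProperSubgroup⇒⊆maximal {H} = go H (⊃-wellFounded H)
    where
    go : ∀ H → Acc _⊃_ H → ProperSubgroup H → ∃ λ M → IsMaximal G M × H ⊆ M
    go H (acc rec) pH with anySubset? (λ K → (H ⊂? K) ×-dec properSubgroup? K)
    ... | yes (K , H⊂K , pK) = let M , mM , K⊆M = go K (rec H⊂K) pK in M , mM , K⊆M ∘ proj₁ H⊂K
    ... | no ∄               = H , Equivalence.to MaximalProper⇔IsMaximal (pH , ∄) , id

  Derivable : Subset N → Fin N → Set
  Derivable T z = z ≡ e G ⊎ (∃₂ λ a b → a ∈ T × b ∈ T × a ⋆ b ≡ z) ⊎ (∃ λ a → a ∈ T × inv G a ≡ z)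

  derivable? : ∀ T → Decidable (Derivable T)
  derivable? T z =
    (z ≟ᶠ e G)
    ⊎-dec any? (λ a → any? (λ b → (a ∈? T) ×-dec (b ∈? T) ×-dec ((a ⋆ b) ≟ᶠ z)))
    ⊎-dec any? (λ a → (a ∈? T) ×-dec (inv G a ≟ᶠ z))

  Derivable⇒InGen : T ⊆⟨ S ⟩ → ∀ {z} → Derivable T z → InGen G S z
  Derivable⇒InGen T⊆⟨S⟩ (inj₁ refl)                         = one
  Derivable⇒InGen T⊆⟨S⟩ (inj₂ (inj₁ (a , b , a∈ , b∈ , refl))) = mul (T⊆⟨S⟩ a∈) (T⊆⟨S⟩ b∈)
  Derivable⇒InGen T⊆⟨S⟩ (inj₂ (inj₂ (a , a∈ , refl)))         = inve (T⊆⟨S⟩ a∈)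

  closure : ∀ S → ∃ λ C → S ⊆ C × IsSubgroup G C × C ⊆⟨ S ⟩
  closure S = go S (⊃-wellFounded S) id gen
    where
    go : ∀ T → Acc _⊃_ T → S ⊆ T → T ⊆⟨ S ⟩ → ∃ λ C → S ⊆ C × IsSubgroup G C × C ⊆⟨ S ⟩
    go T (acc rec) S⊆T T⊆⟨S⟩ with any? (λ z → derivable? T z ×-dec ¬? (z ∈? T))
    ... | yes (z , derivable , z∉T) = go (T ∪ ⁅ z ⁆) (rec (p⊂p∪⁅x⁆ z∉T)) (p⊆p∪q ⁅ z ⁆ ∘ S⊆T) T∪z⊆⟨S⟩
      where
      T∪z⊆⟨S⟩ : (T ∪ ⁅ z ⁆) ⊆⟨ S ⟩
      T∪z⊆⟨S⟩ x∈ with x∈p∪q⁻ T ⁅ z ⁆ x∈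
      ... | inj₁ x∈T   = T⊆⟨S⟩ x∈T
      ... | inj₂ x∈⁅z⁆ = subst (InGen G S) (sym (x∈⁅y⁆⇒x≡y z x∈⁅z⁆)) (Derivable⇒InGen T⊆⟨S⟩ derivable)
    ... | no ∄ = T , S⊆T , (closed (inj₁ refl) , (λ a∈ b∈ → closed (inj₂ (inj₁ (_ , _ , a∈ , b∈ , refl))))
                                               , (λ a∈ → closed (inj₂ (inj₂ (_ , a∈ , refl))))) , T⊆⟨S⟩
      where
      closed : ∀ {z} → Derivable T z → z ∈ T
      closed {z} derivable = decidable-stable (z ∈? T) (λ z∉T → ∄ (z , derivable , z∉T))

  Generates⊎⊆maximal : ∀ S → Generates G S ⊎ ∃ λ M → IsMaximal G M × S ⊆ M
  Generates⊎⊆maximal S with closure S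
  ... | C , S⊆C , sC , C⊆⟨S⟩ with ⊤ ⊆? C
  ...   | yes ⊤⊆C = inj₁ λ x → C⊆⟨S⟩ (⊤⊆C ∈⊤)
  ...   | no ⊤⊈C with ProperSubgroup⇒⊆maximal (sC , p⊆q∧q⊈p⇒p⊂q ⊆⊤ ⊤⊈C)
  ...     | M , mM , C⊆M = inj₂ (M , mM , C⊆M ∘ S⊆C)

  InMaximalsAbove : Subset N → Subset N → Set
  InMaximalsAbove S K = ∀ M → IsMaximal G M → S ⊆ M → K ⊆ M

  structureClass : IsMaximal G M → S ⊆ M → ∃ λ K → IsInter G K × S ⊆ K × InMaximalsAbove S K
  structureClass {M} {S} mM S⊆M = go M (⊂-wellFounded M) (M , [] , mM , [] , refl) S⊆M
    where
    go : ∀ J → Acc _⊂_ J → IsInter G J → S ⊆ J → ∃ λ K → IsInter G K × S ⊆ K × InMaximalsAbove S K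
    go J (acc rec) iJ S⊆J with anySubset? (λ M → isMaximal? M ×-dec (S ⊆? M) ×-dec ¬? (J ⊆? M))
    ... | yes (M , mM , S⊆M , J⊈M) = go (M ∩ J) (rec M∩J⊂J) (extend iJ) (λ x∈ → x∈p∩q⁺ (S⊆M x∈ , S⊆J x∈))
      where
      M∩J⊂J : M ∩ J ⊂ J
      M∩J⊂J with p⊈q⇒∃x∈p∖q J⊈M
      ... | x , x∈J , x∉M = p∩q⊆q M J , x , x∈J , x∉M ∘ p∩q⊆p M J
      extend : IsInter G J → IsInter G (M ∩ J)
      extend (M₀ , Ms , mM₀ , mMs , refl) = M₀ , M ∷ Ms , mM₀ , mM ∷ mMs , refl
    ... | no ∄ = J , iJ , S⊆J , λ M mM S⊆M → decidable-stable (J ⊆? M) (λ J⊈M → ∄ (M , mM , S⊆M , J⊈M))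

  InMaximalsAbove⇒⊆ : InMaximalsAbove S K → IsInter G J → S ⊆ J → K ⊆ J
  InMaximalsAbove⇒⊆ below (M , Ms , mM , mMs , refl) S⊆J with ⊆-foldr-∩⁻ S⊆J
  ... | S⊆M , S⊆Ms = ⊆-foldr-∩⁺ (below M mM S⊆M) (All.zipWith (λ {M′} → uncurry (below M′)) (mMs , S⊆Ms))

  InMaximalsAbove⇒InClass : IsInter G K → S ⊆ K → InMaximalsAbove S K → InClass G K S
  InMaximalsAbove⇒InClass iK S⊆K below =
    inter iK S⊆K λ J iJ J⊂K S⊆J → ⊂-irref refl (⊂-⊆-trans J⊂K (InMaximalsAbove⇒⊆ below iJ S⊆J))

  InMaximalsAbove⇒Generates : InMaximalsAbove S K → Generates G (K ∪ Q) → Generates G (S ∪ Q)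
  InMaximalsAbove⇒Generates {S} {K} {Q} below gen-KQ with Generates⊎⊆maximal (S ∪ Q)
  ... | inj₁ gen-SQ = gen-SQ
  ... | inj₂ (M , mM@(sM , M⊂⊤ , _) , SQ⊆M) =
    ⊥-elim (Generates⇒⊈ gen-KQ (sM , M⊂⊤) (∪-lub (below M mM (SQ⊆M ∘ p⊆p∪q Q)) (SQ⊆M ∘ q⊆p∪q S Q)))

  InMaximalsAbove⇒Deficiency : ∀ {m} → S ⊆ K → InMaximalsAbove S K → Deficiency G S m → Deficiency G K m
  InMaximalsAbove⇒Deficiency S⊆K below ((Q , ∣Q∣≡m , gen-SQ) , minimal) =
    (Q , ∣Q∣≡m , Generates-mono (∪-monoˡ S⊆K) gen-SQ) ,
    λ Q′ gen-KQ′ → minimal Q′ (InMaximalsAbove⇒Generates below gen-KQ′)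

  exchange-lowers-deficiency : ∀ {I Q g q m} → (∀ Q′ → Generates G (I ∪ Q′) → suc m ≤ ∣ Q′ ∣) →
                               ∣ Q ∣ ≡ suc m → Generates G (I ∪ Q) → q ∈ Q → InGen G (⁅ g ⁆ ∪ (Q - q)) q →
                               g ∉ I × Deficiency G (I ∪ ⁅ g ⁆) m
  exchange-lowers-deficiency {I} {Q} {g} {q} {m} minimal ∣Q∣≡1+m gen-IQ q∈Q q-recovered =
    g∉I , (Q - q , ∣Q-q∣≡m , gen-SQ-q) , minimalS
    where
    ∣Q-q∣≡m : ∣ Q - q ∣ ≡ m
    ∣Q-q∣≡m = suc-injective (trans (x∈p⇒suc∣p-x∣≡∣p∣ q∈Q) ∣Q∣≡1+m)
    IQ⊆⟨SQ-q⟩ : (I ∪ Q) ⊆⟨ (I ∪ ⁅ g ⁆) ∪ (Q - q) ⟩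
    IQ⊆⟨SQ-q⟩ {x} x∈ with x∈p∪q⁻ I Q x∈
    ... | inj₁ x∈I = gen (p⊆p∪q (Q - q) (p⊆p∪q ⁅ g ⁆ x∈I))
    ... | inj₂ x∈Q with x ≟ᶠ q
    ...   | yes refl = InGen-trans (gen ∘ ∪-monoˡ (q⊆p∪q I ⁅ g ⁆)) q-recovered
    ...   | no x≢q   = gen (q⊆p∪q (I ∪ ⁅ g ⁆) (Q - q) (x∈p∧x≢y⇒x∈p-y x∈Q x≢q))
    gen-SQ-q : Generates G ((I ∪ ⁅ g ⁆) ∪ (Q - q))
    gen-SQ-q x = InGen-trans IQ⊆⟨SQ-q⟩ (gen-IQ x)
    minimalS : ∀ Q′ → Generates G ((I ∪ ⁅ g ⁆) ∪ Q′) → m ≤ ∣ Q′ ∣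
    minimalS Q′ gen-SQ′ = s≤s⁻¹ (begin
      suc m              ≤⟨ minimal (⁅ g ⁆ ∪ Q′) (subst (Generates G) (∪-assoc I ⁅ g ⁆ Q′) gen-SQ′) ⟩
      ∣ ⁅ g ⁆ ∪ Q′ ∣     ≤⟨ ∣p∪q∣≤∣p∣+∣q∣ ⁅ g ⁆ Q′ ⟩
      ∣ ⁅ g ⁆ ∣ + ∣ Q′ ∣ ≡⟨ cong (_+ ∣ Q′ ∣) (∣⁅x⁆∣≡1 g) ⟩
      suc ∣ Q′ ∣         ∎)
      where open ≤-Reasoning
    g∉I : g ∉ I
    g∉I g∈I = 1+n≰n (≤-trans (minimal (Q - q) (Generates-mono (∪-monoˡ (∪-lub id (x∈p⇒⁅x⁆⊆p g∈I))) gen-SQ-q))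
                             (≤-reflexive ∣Q-q∣≡m))

module OddOrder (A : GroupOps) (isGroup : IsGroup A) where

  open IsGroup isGroup

  private
    group : Bundles.Group 0ℓ 0ℓ
    group = record
      { isGroup = record
        { isMonoid = record
          { isSemigroup = record { isMagma = isMagma (_·_ A) ; assoc = assoc }
          ; identity    = idˡ , idʳ
          }
        ; inverse = invˡ , invʳ
        ; ⁻¹-cong = cong (inv A)
        }
      }

  open GroupProperties group public using (⁻¹-involutive; ε⁻¹≈ε; \\-leftDividesˡ; \\-leftDividesʳ; identityˡ-unique)

  selfInverse⇒≡e : Odd (order A) → ∀ x → inv A x ≡ x → x ≡ e A
  selfInverse⇒≡e odd x x⁻¹≡x with x ≟ᶠ e A
  ... | yes x≡e = x≡e
  ... | no x≢e  = ⊥-elim (Even⇒¬Odd (subst Even (∣⊤∣≡n (order A)) ⊤-even) odd)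
    where
    ⊤-even : Even ∣ ⊤ {order A} ∣
    ⊤-even = fixedPointFree⇒Even (_·_ A x) ⊤
               (λ {y} _ → ∈⊤ , subst (λ z → (A · x) ((A · z) y) ≡ y) x⁻¹≡x (\\-leftDividesˡ x y))
               (λ {y} _ xy≡y → x≢e (identityˡ-unique x y xy≡y))

module Dihedral (A : GroupOps) (isGroup : IsGroup A) (odd : Odd (order A)) where

  open OddOrder A isGroup
  open ≡-Reasoning

  private
    N = order A
    G = Dih A
    _⋆_ = _·_ G
    ι = inv G

  open FiniteGroup G

  decode : Fin (2 * N) → Fin 2 × Fin N
  decode = remQuot N

  sign : Fin (2 * N) → Fin 2
  sign = proj₁ ∘ decode

  value : Fin (2 * N) → Fin N
  value = proj₂ ∘ decode

  decode-injective : ∀ {p q} → decode p ≡ decode q → p ≡ q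
  decode-injective {p} {q} eq =
    trans (sym (combine-remQuot {2} N p)) (trans (cong (uncurry combine) eq) (combine-remQuot {2} N q))

  decode-· : ∀ p q → decode (p ⋆ q) ≡ dmul A (decode p) (decode q)
  decode-· p q = remQuot-combine _ _

  decode-inv : ∀ p → decode (ι p) ≡ dinv A (decode p)
  decode-inv p = remQuot-combine _ _

  decode-e : decode (e G) ≡ (zero , e A)
  decode-e = remQuot-combine _ _

  sign-· : ∀ p q → sign (p ⋆ q) ≡ xor2 A (sign p) (sign q)
  sign-· p q = cong proj₁ (decode-· p q)

  Rotations : Subset (2 * N)
  Rotations = fromDecidable (λ p → sign p ≟ᶠ zero)

  rotation⁺ : ∀ {p} → sign p ≡ zero → p ∈ Rotations
  rotation⁺ = fromDecidable⁺ (λ p → sign p ≟ᶠ zero)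

  rotation⁻ : ∀ {p} → p ∈ Rotations → sign p ≡ zero
  rotation⁻ = fromDecidable⁻ (λ p → sign p ≟ᶠ zero)

  reflection⁻ : ∀ {p} → p ∉ Rotations → sign p ≡ suc zero
  reflection⁻ {p} p∉ = nonzero (sign p) (p∉ ∘ rotation⁺)
    where
    nonzero : (s : Fin 2) → s ≢ zero → s ≡ suc zero
    nonzero zero       s≢0 = ⊥-elim (s≢0 refl)
    nonzero (suc zero) _   = refl

  decode-rotation : ∀ {p} → p ∈ Rotations → decode p ≡ (zero , value p)
  decode-rotation {p} p∈ = cong (_, value p) (rotation⁻ p∈)

  decode-reflection : ∀ {p} → p ∉ Rotations → decode p ≡ (suc zero , value p)
  decode-reflection {p} p∉ = cong (_, value p) (reflection⁻ p∉)

  Rotations-isSubgroup : IsSubgroup G Rotations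
  Rotations-isSubgroup =
    rotation⁺ (cong proj₁ decode-e) ,
    (λ {x} {y} x∈ y∈ → rotation⁺ (trans (sign-· x y) (cong₂ (xor2 A) (rotation⁻ x∈) (rotation⁻ y∈)))) ,
    (λ {x} x∈ → rotation⁺ (trans (cong proj₁ (decode-inv x)) (rotation⁻ x∈)))

  reflection-involutive : ∀ {r} → r ∉ Rotations → ∀ y → r ⋆ (r ⋆ y) ≡ y
  reflection-involutive {r} r∉ y = decode-injective (begin
    decode (r ⋆ (r ⋆ y))                                                 ≡⟨ decode-· r (r ⋆ y) ⟩
    dmul A (decode r) (decode (r ⋆ y))                                   ≡⟨ cong (dmul A (decode r)) (decode-· r y) ⟩
    dmul A (decode r) (dmul A (decode r) (decode y))                     ≡⟨ cong (λ u → dmul A u (dmul A u (decode y))) (decode-reflection r∉) ⟩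
    dmul A (suc zero , value r) (dmul A (suc zero , value r) (decode y)) ≡⟨ twice (value r) (decode y) ⟩
    decode y                                                             ∎)
    where
    twice : ∀ a v → dmul A (suc zero , a) (dmul A (suc zero , a) v) ≡ v
    twice a (zero , b)     = cong (zero ,_) (\\-leftDividesʳ a b)
    twice a (suc zero , b) = cong (suc zero ,_) (\\-leftDividesˡ a b)

  reflection-moves : ∀ {r} → r ∉ Rotations → ∀ y → r ⋆ y ≢ y
  reflection-moves {r} r∉ y ry≡y = flips (sign y) (begin
    xor2 A (suc zero) (sign y)  ≡⟨ cong (λ s → xor2 A s (sign y)) (reflection⁻ r∉) ⟨
    xor2 A (sign r) (sign y)    ≡⟨ sign-· r y ⟨
    sign (r ⋆ y)                ≡⟨ cong sign ry≡y ⟩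
    sign y                      ∎)
    where
    flips : ∀ s → xor2 A (suc zero) s ≢ s
    flips zero ()
    flips (suc zero) ()

  reflection·reflection : ∀ {r y} → r ∉ Rotations → y ∉ Rotations → r ⋆ y ∈ Rotations
  reflection·reflection {r} {y} r∉ y∉ =
    rotation⁺ (trans (sign-· r y) (cong₂ (xor2 A) (reflection⁻ r∉) (reflection⁻ y∉)))

  Rotations-proper : ProperSubgroup Rotations
  Rotations-proper = Rotations-isSubgroup , ⊆⊤ , x₀ , ∈⊤ , x₀∉
    where
    x₀ = combine {2} {N} (suc zero) (e A)
    x₀∉ : x₀ ∉ Rotations
    x₀∉ x₀∈ with trans (sym (cong proj₁ (remQuot-combine {2} {N} (suc zero) (e A)))) (rotation⁻ x₀∈)
    ... | ()

  Rotations-isMaximal : IsMaximal G Rotations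
  Rotations-isMaximal = Equivalence.to MaximalProper⇔IsMaximal (Rotations-proper , no-overgroup)
    where
    no-overgroup : ¬ ∃ λ K → Rotations ⊂ K × ProperSubgroup K
    no-overgroup (K , (Rot⊆K , r , r∈K , r∉) , (_ , ·∈K , _) , (_ , x , _ , x∉K)) = x∉K (everything x)
      where
      everything : ∀ y → y ∈ K
      everything y with y ∈? Rotations
      ... | yes y∈ = Rot⊆K y∈
      ... | no y∉  = subst (_∈ K) (reflection-involutive r∉ y) (·∈K r∈K (Rot⊆K (reflection·reflection r∉ y∉)))

  oddSubgroup⇒⊆Rotations : ∀ {H} → IsSubgroup G H → Odd ∣ H ∣ → H ⊆ Rotations
  oddSubgroup⇒⊆Rotations {H} (_ , ·∈H , _) oddH {p} p∈H = decidable-stable (p ∈? Rotations) λ p∉ →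
    Even⇒¬Odd (fixedPointFree⇒Even (p ⋆_) H (λ y∈ → ·∈H p∈H y∈ , reflection-involutive p∉ _)
                                              (λ {y} _ → reflection-moves p∉ y))
              oddH

  ⊆Rotations⇒Odd : ∀ {H} → IsSubgroup G H → H ⊆ Rotations → Odd ∣ H ∣
  ⊆Rotations⇒Odd {H} (e∈H , _ , ⁻¹∈H) H⊆Rot =
    uniqueFixedPoint⇒Odd ι H (λ x∈ → ⁻¹∈H x∈ , ι-involutive (H⊆Rot x∈)) e∈H ι-e fixed⇒e
    where
    decode-ι : ∀ {x} → x ∈ Rotations → decode (ι x) ≡ (zero , inv A (value x))
    decode-ι {x} x∈ = trans (decode-inv x) (cong (dinv A) (decode-rotation x∈))
    ι-involutive : ∀ {x} → x ∈ Rotations → ι (ι x) ≡ x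
    ι-involutive {x} x∈ = decode-injective (begin
      decode (ι (ι x))                 ≡⟨ decode-inv (ι x) ⟩
      dinv A (decode (ι x))            ≡⟨ cong (dinv A) (decode-ι x∈) ⟩
      (zero , inv A (inv A (value x))) ≡⟨ cong (zero ,_) (⁻¹-involutive (value x)) ⟩
      (zero , value x)                 ≡⟨ decode-rotation x∈ ⟨
      decode x                         ∎)
    ι-e : ι (e G) ≡ e G
    ι-e = decode-injective (begin
      decode (ι (e G))      ≡⟨ decode-inv (e G) ⟩
      dinv A (decode (e G)) ≡⟨ cong (dinv A) decode-e ⟩
      (zero , inv A (e A))  ≡⟨ cong (zero ,_) ε⁻¹≈ε ⟩
      (zero , e A)          ≡⟨ decode-e ⟨
      decode (e G)          ∎)
    fixed⇒e : ∀ {x} → x ∈ H → ι x ≡ x → x ≡ e G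
    fixed⇒e {x} x∈ ιx≡x = decode-injective (begin
      decode x         ≡⟨ decode-rotation (H⊆Rot x∈) ⟩
      (zero , value x) ≡⟨ cong (zero ,_) (selfInverse⇒≡e odd (value x) value-selfInverse) ⟩
      (zero , e A)     ≡⟨ decode-e ⟨
      decode (e G)     ∎)
      where
      value-selfInverse : inv A (value x) ≡ value x
      value-selfInverse = trans (sym (cong proj₂ (decode-ι (H⊆Rot x∈)))) (cong value ιx≡x)

  -- q is a rotation, or q = r ⋆ (r ⋆ q) with r ⋆ q a rotation.
  trade-for-rotation : ∀ {r} → r ∉ Rotations → ∀ q →
                       ∃ λ g → g ∈ Rotations × ∀ {T} → g ∈ T → r ∈ T → InGen G T q
  trade-for-rotation {r} r∉ q with q ∈? Rotations
  ... | yes q∈ = q , q∈ , λ g∈ _ → gen g∈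
  ... | no q∉  = r ⋆ q , reflection·reflection r∉ q∉ ,
                 λ g∈ r∈ → subst (InGen G _) (reflection-involutive r∉ q) (mul (gen r∈) (gen g∈))

  generators-contain-reflection : ∀ {I Q} → I ⊆ Rotations → Generates G (I ∪ Q) → ∃ λ r → r ∈ Q × r ∉ Rotations
  generators-contain-reflection I⊆Rot gen-IQ = p⊈q⇒∃x∈p∖q (Generates⇒⊈ gen-IQ Rotations-proper ∘ ∪-lub I⊆Rot)

  ⊆Rotations⇒option : ∀ k {I} → I ⊆ Rotations → Deficiency G I (suc (suc k)) →
                     ∃ λ K → IsOption G I K × InO G (suc k) K
  ⊆Rotations⇒option k {I} I⊆Rot ((Q , ∣Q∣≡2+k , gen-IQ) , minimal)
    with generators-contain-reflection I⊆Rot gen-IQ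
  ... | r , r∈Q , r∉ with x∈p∧1<∣p∣⇒∃[p-x] r∈Q (subst (1 <_) (sym ∣Q∣≡2+k) (s≤s (s≤s z≤n)))
  ... | q , q∈Q-r with trade-for-rotation r∉ q
  ... | g , g∈Rot , recovers
    with exchange-lowers-deficiency minimal ∣Q∣≡2+k gen-IQ (p─q⊆p Q ⁅ r ⁆ q∈Q-r)
           (recovers (p⊆p∪q (Q - q) (x∈⁅x⁆ g)) (q⊆p∪q ⁅ g ⁆ (Q - q) (x∈p∧x≢y⇒x∈p-y r∈Q (x∈p-y⇒x≢y q∈Q-r ∘ sym))))
  ... | g∉I , δS with ∪-lub I⊆Rot (x∈p⇒⁅x⁆⊆p g∈Rot)
  ... | S⊆Rot with structureClass Rotations-isMaximal S⊆Rot
  ... | K , iK , S⊆K , below =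
    K , (g , g∉I , InMaximalsAbove⇒InClass iK S⊆K below) ,
    inj₁ iK ,
    ⊆Rotations⇒Odd (IsInter⇒IsSubgroup iK) (below Rotations Rotations-isMaximal S⊆Rot) ,
    InMaximalsAbove⇒Deficiency S⊆K below δS

  O-option : ∀ k {I} → InO G (suc (suc k)) I → ∃ λ K → IsOption G I K × InO G (suc k) K
  O-option k (index , oddI , δI) =
    ⊆Rotations⇒option k (oddSubgroup⇒⊆Rotations (ClassIndex⇒IsSubgroup index) oddI) δI

lemma5p4 : (A : GroupOps) → IsGroup A → IsAbelian A → Odd (order A) → Rank A 2
         → (m : ℕ) → (m ≡ 2 ⊎ m ≡ 3)
         → (I : Subset (order (Dih A))) → InO (Dih A) m I
         → Σ (Subset (order (Dih A))) λ K → IsOption (Dih A) I K × InO (Dih A) (m ∸ 1) K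
lemma5p4 A isGroup _ odd _ _ (inj₁ refl) I = Dihedral.O-option A isGroup odd 0
lemma5p4 A isGroup _ odd _ _ (inj₂ refl) I = Dihedral.O-option A isGroup odd 1
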